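{- For each non-negative integer $n$, \[ \sum_{k=0}^n (-1)^{k} \binom {n+k}{k} F_{n+1-k} = 1 - 2\sum_{k=0}^{n-1} (-1)^{k} \binom {2k+1}{k} \qquad\text{and}\qquad \sum_{k=0}^n (-1)^{k} \binom {n+k}{k} L_{n+1-k} = 1. \]
   Context: $F_j$ and $L_j$ denote the Fibonacci and Lucas numbers: $F_0=0,F_1=1$, $L_0=2,L_1=1$, both satisfying $X_j=X_{j-1}+X_{j-2}$. -}

module Defs where

open import Data.Nat using (ℕ; zero; suc)
open import Data.Integer using (ℤ; +_; _+_; -_)

fib : ℕ → ℤ
fib zero = + 0
fib (suc zero) = + 1
fib (suc (suc n)) = fib (suc n) + fib n

lucas : ℕ → ℤ
lucas zero = + 2
lucas (suc zero) = + 1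
lucas (suc (suc n)) = lucas (suc n) + lucas n

sgn : ℕ → ℤ
sgn zero = + 1
sgn (suc k) = - sgn k

sumBelow : ℕ → (ℕ → ℤ) → ℤ
sumBelow zero f = + 0
sumBelow (suc n) f = sumBelow n f + f n

{-# OPTIONS --safe #-}
-- Write Sₙ(X) = Σ_{k≤n} (-1)^k C(n+k,k) X_{n+1-k}, the coefficient of x^n in
-- (X_1 + X_2 x + ⋯)/(1+x)^(n+1). For any sequence X with X_{j+2} = X_{j+1} + X_j,
-- Pascal's rule in the form (1+x)^{-(n+2)}(1+x) = (1+x)^{-(n+1)} together with the
-- recurrence shows that Sₙ₊₁(X) - Sₙ(X) only involves the two boundary terms
-- X_0, X_1, weighted by C(2n+1,n) and C(2n+2,n+1) = 2 C(2n+1,n). Summing,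
-- Sₙ(X) = X_1 + (X_0 - 2 X_1) Σ_{k<n} (-1)^k C(2k+1,k), and the two identities are
-- the cases X = F (X_0 = 0, X_1 = 1) and X = L (X_0 = 2, X_1 = 1).
module Submission where

open import Defs
open import Data.Nat using (ℕ; zero; suc; _∸_; _<_) renaming (_+_ to _+ℕ_; _*_ to _*ℕ_)
import Data.Nat.Properties as ℕ
open import Data.Nat.Combinatorics using (_C_; nCk≡nC[n∸k]; nCk+nC[k+1]≡[n+1]C[k+1])
open import Data.Integer using (ℤ; +_; -_; _+_; _*_; _-_)
import Data.Integer.Properties as ℤ
open import Data.Integer.Tactic.RingSolver using (solve-∀)
open import Data.Product using (_×_; _,_)
open import Function using (_∘_)
open import Relation.Binary.PropositionalEquality
open ≡-Reasoning

i+j≡k⇒i≡k-j : ∀ {i j k} → i + j ≡ k → i ≡ k - j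
i+j≡k⇒i≡k-j {i} {j} refl = cancel i j
  where
  cancel : ∀ i j → i ≡ (i + j) - j
  cancel = solve-∀

sumBelow-cong : ∀ m {f g : ℕ → ℤ} → (∀ k → k < m → f k ≡ g k) → sumBelow m f ≡ sumBelow m g
sumBelow-cong zero    f≗g = refl
sumBelow-cong (suc m) f≗g =
  cong₂ _+_ (sumBelow-cong m (λ k k<m → f≗g k (ℕ.m<n⇒m<1+n k<m))) (f≗g m ℕ.≤-refl)

sumBelow-+ : ∀ m (f g : ℕ → ℤ) → sumBelow m (λ k → f k + g k) ≡ sumBelow m f + sumBelow m g
sumBelow-+ zero    f g = refl
sumBelow-+ (suc m) f g = begin
  sumBelow m (λ k → f k + g k) + (f m + g m)  ≡⟨ cong (_+ (f m + g m)) (sumBelow-+ m f g) ⟩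
  (sumBelow m f + sumBelow m g) + (f m + g m) ≡⟨ interchange (sumBelow m f) (sumBelow m g) (f m) (g m) ⟩
  (sumBelow m f + f m) + (sumBelow m g + g m) ∎
  where
  interchange : ∀ a b c d → (a + b) + (c + d) ≡ (a + c) + (b + d)
  interchange = solve-∀

sumBelow-- : ∀ m (f g : ℕ → ℤ) → sumBelow m (λ k → f k - g k) ≡ sumBelow m f - sumBelow m g
sumBelow-- zero    f g = refl
sumBelow-- (suc m) f g = begin
  sumBelow m (λ k → f k - g k) + (f m - g m)  ≡⟨ cong (_+ (f m - g m)) (sumBelow-- m f g) ⟩
  (sumBelow m f - sumBelow m g) + (f m - g m) ≡⟨ interchange (sumBelow m f) (sumBelow m g) (f m) (g m) ⟩
  (sumBelow m f + f m) - (sumBelow m g + g m) ∎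
  where
  interchange : ∀ a b c d → (a - b) + (c - d) ≡ (a + c) - (b + d)
  interchange = solve-∀

sumBelow-head : ∀ m (f : ℕ → ℤ) → sumBelow (suc m) f ≡ f 0 + sumBelow m (f ∘ suc)
sumBelow-head zero    f = ℤ.+-comm (+ 0) (f 0)
sumBelow-head (suc m) f = trans (cong (_+ f (suc m)) (sumBelow-head m f)) (ℤ.+-assoc (f 0) _ _)

-- altBinom n k is the coefficient of x^k in (1+x)^{-(n+1)}.
altBinom : ℕ → ℕ → ℤ
altBinom n k = sgn k * + ((n +ℕ k) C k)

altBinom-pascal : ∀ n k → altBinom (suc n) (suc k) ≡ altBinom n (suc k) - altBinom (suc n) k
altBinom-pascal n k = begin
  - sgn k * + (suc (n +ℕ suc k) C suc k)
    ≡⟨ cong (λ t → - sgn k * + t) (nCk+nC[k+1]≡[n+1]C[k+1] (n +ℕ suc k) k) ⟨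
  - sgn k * + ((n +ℕ suc k) C k +ℕ (n +ℕ suc k) C suc k)
    ≡⟨ cong (- sgn k *_) (ℤ.pos-+ ((n +ℕ suc k) C k) _) ⟩
  - sgn k * (+ ((n +ℕ suc k) C k) + + ((n +ℕ suc k) C suc k))
    ≡⟨ distribute (sgn k) _ _ ⟩
  - sgn k * + ((n +ℕ suc k) C suc k) - sgn k * + ((n +ℕ suc k) C k)
    ≡⟨ cong (λ t → - sgn k * + ((n +ℕ suc k) C suc k) - sgn k * + (t C k)) (ℕ.+-suc n k) ⟩
  - sgn k * + ((n +ℕ suc k) C suc k) - sgn k * + ((suc n +ℕ k) C k) ∎
  where
  distribute : ∀ s a b → - s * (a + b) ≡ - s * b - s * a
  distribute = solve-∀

-- altConv n m X is the coefficient of x^m in X(x)/(1+x)^(n+1).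
altConv : ℕ → ℕ → (ℕ → ℤ) → ℤ
altConv n m X = sumBelow (suc m) (λ k → altBinom n k * X (m ∸ k))

altConv-+ : ∀ n m (X Y : ℕ → ℤ) → altConv n m (λ j → X j + Y j) ≡ altConv n m X + altConv n m Y
altConv-+ n m X Y = trans
  (sumBelow-cong (suc m) (λ k _ → ℤ.*-distribˡ-+ (altBinom n k) (X (m ∸ k)) (Y (m ∸ k))))
  (sumBelow-+ (suc m) _ _)

altConv-pascal : ∀ n m X → altConv (suc n) (suc m) X ≡ altConv n (suc m) X - altConv (suc n) m X
altConv-pascal n m X = begin
  altConv (suc n) (suc m) X
    ≡⟨ sumBelow-head (suc m) _ ⟩
  head + sumBelow (suc m) (λ k → altBinom (suc n) (suc k) * X (m ∸ k))
    ≡⟨ cong (λ t → head + t) (sumBelow-cong (suc m) (λ k _ →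
         trans (cong (_* X (m ∸ k)) (altBinom-pascal n k))
               (distribʳ-- (altBinom n (suc k)) (altBinom (suc n) k) (X (m ∸ k))))) ⟩
  head + sumBelow (suc m) (λ k → altBinom n (suc k) * X (m ∸ k) - altBinom (suc n) k * X (m ∸ k))
    ≡⟨ cong (λ t → head + t) (sumBelow-- (suc m) _ _) ⟩
  head + (sumBelow (suc m) (λ k → altBinom n (suc k) * X (m ∸ k)) - altConv (suc n) m X)
    ≡⟨ ℤ.+-assoc head _ _ ⟨
  (head + sumBelow (suc m) (λ k → altBinom n (suc k) * X (m ∸ k))) - altConv (suc n) m X
    ≡⟨ cong (_- altConv (suc n) m X) (sumBelow-head (suc m) _) ⟨
  altConv n (suc m) X - altConv (suc n) m X ∎
  where
  head : ℤ
  head = altBinom 0 0 * X (suc m)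
  distribʳ-- : ∀ a b x → (a - b) * x ≡ a * x - b * x
  distribʳ-- = solve-∀

sumBelow-shift : ∀ a m (X : ℕ → ℤ) →
  sumBelow (suc m) (λ k → altBinom a k * X (suc m ∸ k)) ≡ altConv a m (X ∘ suc)
sumBelow-shift a m X = sumBelow-cong (suc m) (λ k k≤m →
  cong (λ j → altBinom a k * X j) (ℕ.+-∸-assoc 1 (ℕ.≤-pred k≤m)))

altConv-suc : ∀ a m X → altConv a (suc m) X ≡ altConv a m (X ∘ suc) + altBinom a (suc m) * X 0
altConv-suc a m X = cong₂ _+_ (sumBelow-shift a m X)
  (cong (λ j → altBinom a (suc m) * X j) (ℕ.n∸n≡0 m))

central : ℕ → ℕ
central n = (2 *ℕ n +ℕ 1) C n

2n+1≡n+[1+n] : ∀ n → 2 *ℕ n +ℕ 1 ≡ n +ℕ suc n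
2n+1≡n+[1+n] n = begin
  (n +ℕ (n +ℕ 0)) +ℕ 1 ≡⟨ cong (λ t → (n +ℕ t) +ℕ 1) (ℕ.+-identityʳ n) ⟩
  (n +ℕ n) +ℕ 1        ≡⟨ ℕ.+-assoc n n 1 ⟩
  n +ℕ (n +ℕ 1)        ≡⟨ cong (n +ℕ_) (ℕ.+-comm n 1) ⟩
  n +ℕ suc n           ∎

central-sym : ∀ n → (n +ℕ suc n) C suc n ≡ central n
central-sym n = begin
  (n +ℕ suc n) C suc n              ≡⟨ cong ((n +ℕ suc n) C_) (ℕ.m+n∸m≡n n (suc n)) ⟨
  (n +ℕ suc n) C (n +ℕ suc n ∸ n)   ≡⟨ nCk≡nC[n∸k] (ℕ.m≤m+n n (suc n)) ⟨
  (n +ℕ suc n) C n                  ≡⟨ cong (_C n) (2n+1≡n+[1+n] n) ⟨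
  central n                         ∎

central-double : ∀ n → (suc n +ℕ suc n) C suc n ≡ central n +ℕ central n
central-double n = begin
  suc (n +ℕ suc n) C suc n                      ≡⟨ nCk+nC[k+1]≡[n+1]C[k+1] (n +ℕ suc n) n ⟨
  (n +ℕ suc n) C n +ℕ (n +ℕ suc n) C suc n      ≡⟨ cong₂ _+ℕ_ (cong (_C n) (2n+1≡n+[1+n] n)) (sym (central-sym n)) ⟨
  central n +ℕ central n                        ∎

altBinom-diag : ∀ n → altBinom n (suc n) ≡ - sgn n * + central n
altBinom-diag n = cong (λ t → - sgn n * + t) (central-sym n)

altBinom-suc-diag : ∀ n → altBinom (suc n) (suc n) ≡ - sgn n * (+ central n + + central n)
altBinom-suc-diag n = trans (cong (λ t → - sgn n * + t) (central-double n))
  (cong (- sgn n *_) (ℤ.pos-+ (central n) (central n)))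

FibonacciLike : (ℕ → ℤ) → Set
FibonacciLike X = ∀ j → X (suc (suc j)) ≡ X (suc j) + X j

fib-fibonacciLike : FibonacciLike fib
fib-fibonacciLike _ = refl

lucas-fibonacciLike : FibonacciLike lucas
lucas-fibonacciLike _ = refl

module _ {X : ℕ → ℤ} (X-rec : FibonacciLike X) where

  private
    S : ℕ → ℤ
    S n = altConv n n (X ∘ suc)

  -- The recurrence splits off altConv (suc n) n X, which Pascal's rule then cancels.
  altConv-diag-suc+boundary : ∀ n →
    altConv (suc n) (suc n) (X ∘ suc) + altBinom (suc n) (suc n) * X 0
      ≡ (altConv n n (X ∘ suc) + altBinom n (suc n) * X 0) + altBinom (suc n) (suc n) * X 1
  altConv-diag-suc+boundary n = begin
    S (suc n) + d * X 0
      ≡⟨ cong (_+ d * X 0) (altConv-suc (suc n) n (X ∘ suc)) ⟩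
    (altConv (suc n) n (X ∘ suc ∘ suc) + d * X 1) + d * X 0
      ≡⟨ cong (λ t → (t + d * X 1) + d * X 0) (trans
           (sumBelow-cong (suc n) (λ k _ → cong (altBinom (suc n) k *_) (X-rec (n ∸ k))))
           (altConv-+ (suc n) n (X ∘ suc) X)) ⟩
    ((altConv (suc n) n (X ∘ suc) + altConv (suc n) n X) + d * X 1) + d * X 0
      ≡⟨ rearrange (altConv (suc n) n (X ∘ suc)) (altConv (suc n) n X) (d * X 1) (d * X 0) ⟩
    ((altConv (suc n) n (X ∘ suc) + d * X 0) + altConv (suc n) n X) + d * X 1
      ≡⟨ cong (λ t → (t + altConv (suc n) n X) + d * X 1) (altConv-suc (suc n) n X) ⟨
    (altConv (suc n) (suc n) X + altConv (suc n) n X) + d * X 1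
      ≡⟨ cong (λ t → (t + altConv (suc n) n X) + d * X 1) (altConv-pascal n n X) ⟩
    ((altConv n (suc n) X - altConv (suc n) n X) + altConv (suc n) n X) + d * X 1
      ≡⟨ cong (_+ d * X 1) (subtract-add (altConv n (suc n) X) (altConv (suc n) n X)) ⟩
    altConv n (suc n) X + d * X 1
      ≡⟨ cong (_+ d * X 1) (altConv-suc n n X) ⟩
    (S n + altBinom n (suc n) * X 0) + d * X 1 ∎
    where
    d : ℤ
    d = altBinom (suc n) (suc n)
    rearrange : ∀ a b p q → ((a + b) + p) + q ≡ ((a + q) + b) + p
    rearrange = solve-∀
    subtract-add : ∀ a b → (a - b) + b ≡ a
    subtract-add = solve-∀

  altConv-diag-suc : ∀ n →
    altConv (suc n) (suc n) (X ∘ suc) ≡ altConv n n (X ∘ suc) + sgn n * + central n * (X 0 - + 2 * X 1)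
  altConv-diag-suc n = begin
    S (suc n)
      ≡⟨ i+j≡k⇒i≡k-j (altConv-diag-suc+boundary n) ⟩
    (S n + altBinom n (suc n) * X 0) + altBinom (suc n) (suc n) * X 1 - altBinom (suc n) (suc n) * X 0
      ≡⟨ cong₂ (λ e d → (S n + e * X 0) + d * X 1 - d * X 0) (altBinom-diag n) (altBinom-suc-diag n) ⟩
    (S n + - sgn n * c * X 0) + - sgn n * (c + c) * X 1 - - sgn n * (c + c) * X 0
      ≡⟨ collect (S n) (sgn n) c (X 0) (X 1) ⟩
    S n + sgn n * c * (X 0 - + 2 * X 1) ∎
    where
    c : ℤ
    c = + central n
    collect : ∀ a s c x₀ x₁ →
      (a + - s * c * x₀) + - s * (c + c) * x₁ - - s * (c + c) * x₀ ≡ a + s * c * (x₀ - + 2 * x₁)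
    collect = solve-∀

  altConv-diag : ∀ n →
    altConv n n (X ∘ suc) ≡ X 1 + (X 0 - + 2 * X 1) * sumBelow n (λ k → sgn k * + central k)
  altConv-diag zero = base (X 0) (X 1)
    where
    base : ∀ x₀ x₁ → + 0 + + 1 * + 1 * x₁ ≡ x₁ + (x₀ - + 2 * x₁) * + 0
    base = solve-∀
  altConv-diag (suc n) = begin
    S (suc n)                                   ≡⟨ altConv-diag-suc n ⟩
    S n + sgn n * + central n * δ               ≡⟨ cong (_+ sgn n * + central n * δ) (altConv-diag n) ⟩
    (X 1 + δ * E) + sgn n * + central n * δ     ≡⟨ collect (X 1) δ E (sgn n * + central n) ⟩
    X 1 + δ * (E + sgn n * + central n)         ∎
    where
    δ : ℤ
    δ = X 0 - + 2 * X 1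
    E : ℤ
    E = sumBelow n (λ k → sgn k * + central k)
    collect : ∀ x d e t → (x + d * e) + t * d ≡ x + d * (e + t)
    collect = solve-∀

theorem12 : (n : ℕ) →
    (sumBelow (suc n) (λ k → sgn k * + ((n +ℕ k) C k) * fib (suc n ∸ k))
      ≡ + 1 - + 2 * sumBelow n (λ k → sgn k * + ((2 *ℕ k +ℕ 1) C k)))
    × (sumBelow (suc n) (λ k → sgn k * + ((n +ℕ k) C k) * lucas (suc n ∸ k))
      ≡ + 1)
theorem12 n =
  trans (sumBelow-shift n n fib) (trans (altConv-diag {fib} fib-fibonacciLike n) (fib-case E)) ,
  trans (sumBelow-shift n n lucas) (trans (altConv-diag {lucas} lucas-fibonacciLike n) (lucas-case E))
  where
  E : ℤ
  E = sumBelow n (λ k → sgn k * + central k)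
  fib-case : ∀ e → + 1 + (+ 0 - + 2 * + 1) * e ≡ + 1 - + 2 * e
  fib-case = solve-∀
  lucas-case : ∀ e → + 1 + (+ 2 - + 2 * + 1) * e ≡ + 1
  lucas-case = solve-∀
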